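{- Let $m\ge 2$, let $r\in\{1,\dots,2m-2\}$, $d:=\gcd(r,2m-1)$ and $c:=\frac{2m-1}{d}$. Take the vertex set of $K_{2m}$ to be $\{v_\infty\}\cup\{v_{i,j}: i\in[c], j\in[d]\}$, with $v_{i,j}=v_{i',j'}$ whenever $i\equiv i'\pmod c$, $j\equiv j'\pmod d$. For an integer $x$ and odd $y$ let $P_{x,y}=\{\{x+l,x-l\}: l\in[\frac{y+1}{2}]\}$ (entries mod $y$). For $i\in[c],j\in[d]$ (first subscript of $M$ and $\ell$ taken mod $c$) let $M_{i,j}$ be the matching with edge set $\{\{v_\infty,v_{i,j}\}\}\cup\{\{v_{a_1,b_1},v_{a_2,b_2}\}:\{a_1,a_2\}\in P_{i,c},\{b_1,b_2\}\in P_{j,d}, a_1\ne i\text{ or } b_1\ne j\}$, and let $\ell_{i,j}$ be its ordering given by $\ell_{i,j}(\{v_\infty,v_{i,j}\})=0$; $\ell_{i,j}(\{v_{i+x,j},v_{i-x,j}\})=x$ for $x\in[\frac{c+1}{2}]\setminus\{0\}$; $\ell_{i,j}(\{v_{i+2x,j+y},v_{i-2x,j-y}\})=(y-1)c+\frac{c+1}{2}+\bigl(x+i\tfrac{c-1}{2}\bmod c\bigr)$ for $x\in[c]$, $y\in[\frac{d+1}{2}]\setminus\{0\}$. Then $ms(\ell_{i,j},\ell_{i+1,j})\ge m-1$ for all $i\in[c]$ and $j\in[d]$.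
   Context: For an integer $N$, $[N]=\{0,\dots,N-1\}$ and $x\bmod N\in[N]$. An ordering of a graph $H=(V,E)$ is a bijection $E\to[|E|]$. For edge-disjoint graphs $H,H'$ on the same vertex set with orderings $\ell,\ell'$, consider the list of edges of $H$ in the order given by $\ell$ followed by the edges of $H'$ in the order given by $\ell'$; $ms(\ell,\ell')$ is the largest integer $s$ such that every $s$ consecutive entries of this list that include at least one edge of $H$ and at least one edge of $H'$ form a matching (pairwise disjoint edges). -}

module Defs where

open import Data.Nat as ℕ using (ℕ; zero; suc; _+_; _*_; _∸_; _≤_; _<_; ⌊_/2⌋)
open import Data.Nat.GCD using (gcd)
open import Data.Integer as ℤ using (ℤ; +_; _%ℕ_)
open import Data.Product using (Σ; ∃; ∃-syntax; _×_; _,_)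
open import Data.Sum using (_⊎_)
open import Relation.Binary.PropositionalEquality using (_≡_; _≢_)

-- Total versions of ℕ-division and ℤ-mod-ℕ (value 0 for divisor 0;
-- they are only ever used with nonzero divisors below).

_divN_ : ℕ → ℕ → ℕ
a divN zero = 0
a divN suc k = a ℕ./ suc k

_modN_ : ℕ → ℕ → ℕ
a modN zero = 0
a modN suc k = a ℕ.% suc k

_modZ_ : ℤ → ℕ → ℕ
x modZ zero = 0
x modZ suc k = x %ℕ suc k

dOf : ℕ → ℕ → ℕ
dOf m r = gcd r (2 * m ∸ 1)

cOf : ℕ → ℕ → ℕ
cOf m r = (2 * m ∸ 1) divN dOf m r

-- Vertices of K_{2m}: v∞ and v_{i,j} (i ∈ [c], j ∈ [d]).
-- Only reduced indices are ever produced (via vert), so v_{i,j} = v_{i',j'}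
-- whenever i ≡ i' mod c and j ≡ j' mod d.

data Vtx : Set where
  v∞ : Vtx
  vv : ℕ → ℕ → Vtx

vert : (c d : ℕ) → ℤ → ℤ → Vtx
vert c d a b = vv (a modZ c) (b modZ d)

-- An edge {p,q} is represented by the pair (p , q); equality of edges is
-- equality of unordered pairs.
Edge : Set
Edge = Vtx × Vtx

UEq : {A : Set} → A × A → A × A → Set
UEq (p , q) (p' , q') = (p ≡ p' × q ≡ q') ⊎ (p ≡ q' × q ≡ p')

DisjointEdges : Edge → Edge → Set
DisjointEdges (p , q) (p' , q') = p ≢ p' × p ≢ q' × q ≢ p' × q ≢ q'

InP : ℤ → ℕ → ℕ → ℕ → Set
InP x y a₁ a₂ = ∃[ l ] (l < ⌊ y + 1 /2⌋ ×
  UEq (a₁ , a₂) ((x ℤ.+ + l) modZ y , (x ℤ.- + l) modZ y))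

InM : (c d i j : ℕ) → Edge → Set
InM c d i j e =
    UEq e (v∞ , vert c d (+ i) (+ j))
  ⊎ (∃[ a₁ ] ∃[ a₂ ] ∃[ b₁ ] ∃[ b₂ ]
       (InP (+ i) c a₁ a₂ × InP (+ j) d b₁ b₂ ×
        (a₁ ≢ i ⊎ b₁ ≢ j) ×
        UEq e (vert c d (+ a₁) (+ b₁) , vert c d (+ a₂) (+ b₂))))

-- The ordering ℓ_{i,j}, as a relation:  Ord c d i j e k  means ℓ_{i,j}(e) = k.

Ord : (c d i j : ℕ) → Edge → ℕ → Set
Ord c d i j e k =
    (UEq e (v∞ , vert c d (+ i) (+ j)) × k ≡ 0)
  ⊎ (∃[ x ] (0 < x × x < ⌊ c + 1 /2⌋ ×
       UEq e (vert c d (+ i ℤ.+ + x) (+ j) , vert c d (+ i ℤ.- + x) (+ j)) ×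
       k ≡ x))
  ⊎ (∃[ x ] ∃[ y ] (x < c × 0 < y × y < ⌊ d + 1 /2⌋ ×
       UEq e (vert c d (+ i ℤ.+ + (2 * x)) (+ j ℤ.+ + y) ,
              vert c d (+ i ℤ.- + (2 * x)) (+ j ℤ.- + y)) ×
       k ≡ (y ∸ 1) * c + ⌊ c + 1 /2⌋ + ((x + i * ⌊ c ∸ 1 /2⌋) modN c)))

-- "ℓ is an ordering of H", i.e. a bijection E(H) → [N]
-- (ℓ given as a relation between edges and numbers, H as a predicate on
-- edges, edges compared as unordered pairs).

IsOrdering : (H : Edge → Set) (ℓ : Edge → ℕ → Set) (N : ℕ) → Set
IsOrdering H ℓ N =
    (∀ e k → ℓ e k → H e × k < N)
  × (∀ e → H e → ∃[ k ] ℓ e k)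
  × (∀ e e' k k' → ℓ e k → ℓ e' k' → UEq e e' → k ≡ k')
  × (∀ e e' k → ℓ e k → ℓ e' k → UEq e e')
  × (∀ k → k < N → ∃[ e ] ℓ e k)

EdgeDisjointGraphs : (H H' : Edge → Set) → Set
EdgeDisjointGraphs H H' = ∀ e e' → H e → H' e' → UEq e e' → Data.Empty.⊥
  where import Data.Empty

-- ms.  The list is: edges of H ordered by ℓ (positions 0..N-1), followed
-- by edges of H' ordered by ℓ' (positions N..N+N'-1).
-- At N ℓ ℓ' p e : the entry at position p of the list is e.

At : (N : ℕ) (ℓ ℓ' : Edge → ℕ → Set) → ℕ → Edge → Set
At N ℓ ℓ' p e = (p < N × ℓ e p) ⊎ (∃[ k ] (p ≡ N + k × ℓ' e k))

-- every s consecutive entries (window [t, t+s) inside the list) that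
-- include an edge of H (t < N) and an edge of H' (N < t + s) form a matching
WindowProp : (N N' : ℕ) (ℓ ℓ' : Edge → ℕ → Set) → ℕ → Set
WindowProp N N' ℓ ℓ' s =
  ∀ t → t + s ≤ N + N' → t < N → N < t + s →
  ∀ p q e f → t ≤ p → p < t + s → t ≤ q → q < t + s → p ≢ q →
  At N ℓ ℓ' p e → At N ℓ ℓ' q f → DisjointEdges e f

-- ms(ℓ,ℓ') ≥ k  (ms is the largest s ≤ N + N' satisfying WindowProp)
MsAtLeast : (N N' : ℕ) (ℓ ℓ' : Edge → ℕ → Set) → ℕ → Set
MsAtLeast N N' ℓ ℓ' k = ∃[ s ] (k ≤ s × s ≤ N + N' × WindowProp N N' ℓ ℓ' s)

module Submission where

open import Defs
open import Data.Nat using (ℕ; zero; suc; _+_; _*_; _∸_; _≤_; _<_; _⊓_; ⌊_/2⌋; z≤n; s≤s; z<s; >-nonZero; _≤?_; _<?_; _%_; _/_)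
open import Data.Nat.Properties
open import Data.Nat.DivMod
open import Data.Nat.Divisibility using (_∣_; ∣⇒≤; 0∣⇒≡0; quotient; m∣n⇒n≡quotient*m)
open import Data.Nat.GCD using (gcd; gcd[m,n]∣m; gcd[m,n]∣n)
open import Data.Nat.Tactic.RingSolver using (solve-∀)
open import Data.Integer as ℤ using (-[1+_])
open import Data.Integer.DivMod using (n%ℕd<d)
import Data.Integer.Properties as ℤ
open import Data.Product using (Σ; ∃-syntax; _×_; _,_; proj₁; proj₂; swap)
open import Data.Sum using (_⊎_; inj₁; inj₂)
open import Data.Empty using (⊥; ⊥-elim)
open import Relation.Nullary using (yes; no)
open import Relation.Binary.PropositionalEquality

-- Every vertex u of K_{2m} lies in exactly one edge of M_{i,j}, so ℓ_{i,j}
-- induces a vertex labelling L_{i,j}(u), and ℓ_{i,j}(e) is the common label of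
-- both endpoints of e.  The label of v_{a,b} depends only on the offsets
-- (a − i) mod c and (b − j) mod d; passing from i to i + 1 lowers the first
-- offset by one, so the label drops by at most one:
-- L_{i,j}(u) ≤ L_{i+1,j}(u) + 1.  In a window of m − 1 consecutive entries an
-- edge of ℓ_{i,j} at position p and an edge of ℓ_{i+1,j} at position q satisfy
-- p ≥ q + 2, so they cannot share a vertex.  Finally c and d are odd because
-- c d = 2m − 1, and c ≥ 3 because d ∣ r < 2m − 1.

UEq-refl : ∀ {A : Set} {e : A × A} → UEq e e
UEq-refl = inj₁ (refl , refl)

UEq-reflexive : ∀ {A : Set} {e e' : A × A} → e ≡ e' → UEq e e'
UEq-reflexive refl = UEq-refl

UEq-swap : ∀ {A : Set} {p q : A} → UEq (p , q) (q , p)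
UEq-swap = inj₂ (refl , refl)

UEq-sym : ∀ {A : Set} {e e' : A × A} → UEq e e' → UEq e' e
UEq-sym (inj₁ (refl , refl)) = UEq-refl
UEq-sym (inj₂ (refl , refl)) = UEq-swap

UEq-trans : ∀ {A : Set} {e e' e'' : A × A} → UEq e e' → UEq e' e'' → UEq e e''
UEq-trans (inj₁ (refl , refl)) u = u
UEq-trans (inj₂ (refl , refl)) (inj₁ (refl , refl)) = UEq-swap
UEq-trans (inj₂ (refl , refl)) (inj₂ (refl , refl)) = UEq-refl

DisjointEdges-sym : ∀ {e f} → DisjointEdges e f → DisjointEdges f e
DisjointEdges-sym (p≢p' , p≢q' , q≢p' , q≢q') =
  (λ e → p≢p' (sym e)) , (λ e → q≢p' (sym e)) , (λ e → p≢q' (sym e)) , (λ e → q≢q' (sym e))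

-- Congruences modulo a positive modulus

module Congruence (n-1 : ℕ) where
  n : ℕ
  n = suc n-1

  -- A record rather than a synonym, so that a and b can be inferred from a proof.
  infix 4 _~_
  record _~_ (a b : ℕ) : Set where
    constructor mk
    field un : a % n ≡ b % n
  open _~_ public

  ~-refl : ∀ {a} → a ~ a
  ~-refl = mk refl

  ~-sym : ∀ {a b} → a ~ b → b ~ a
  ~-sym (mk p) = mk (sym p)

  ~-trans : ∀ {a b c} → a ~ b → b ~ c → a ~ c
  ~-trans (mk p) (mk q) = mk (trans p q)

  ≡⇒~ : ∀ {a b} → a ≡ b → a ~ b
  ≡⇒~ e = mk (cong (_% n) e)

  +-~ : ∀ {a b c d} → a ~ b → c ~ d → a + c ~ b + d
  +-~ {a} {b} {c} {d} (mk p) (mk q) = mk (begin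
    (a + c) % n           ≡⟨ %-distribˡ-+ a c n ⟩
    (a % n + c % n) % n   ≡⟨ cong₂ (λ x y → (x + y) % n) p q ⟩
    (b % n + d % n) % n   ≡⟨ %-distribˡ-+ b d n ⟨
    (b + d) % n           ∎)
    where open ≡-Reasoning

  *-~ : ∀ {a b c d} → a ~ b → c ~ d → a * c ~ b * d
  *-~ {a} {b} {c} {d} (mk p) (mk q) = mk (begin
    (a * c) % n           ≡⟨ %-distribˡ-* a c n ⟩
    (a % n * (c % n)) % n ≡⟨ cong₂ (λ x y → (x * y) % n) p q ⟩
    (b % n * (d % n)) % n ≡⟨ %-distribˡ-* b d n ⟨
    (b * d) % n           ∎)
    where open ≡-Reasoning

  %n~ : ∀ a → a % n ~ a
  %n~ a = mk (m%n%n≡m%n a n)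

  +*n~ : ∀ a t → a + t * n ~ a
  +*n~ a t = mk ([m+kn]%n≡m%n a t n)

  +n~ : ∀ a → a + n ~ a
  +n~ a = ~-trans (≡⇒~ (cong (a +_) (sym (+-identityʳ n)))) (+*n~ a 1)

  n~0 : n ~ 0
  n~0 = +n~ 0

  0<n : 0 < n
  0<n = s≤s z≤n

  %n<n : ∀ a → a % n < n
  %n<n a = m%n<n a n

  ~⇒%≡ : ∀ {a b} → b < n → a ~ b → a % n ≡ b
  ~⇒%≡ b<n (mk e) = trans e (m<n⇒m%n≡m b<n)

  ~⇒≡ : ∀ {a b} → a < n → b < n → a ~ b → a ≡ b
  ~⇒≡ a<n b<n e = trans (sym (m<n⇒m%n≡m a<n)) (~⇒%≡ b<n e)

  ≁0 : ∀ {x} → 0 < x → x < n → x ~ 0 → ⊥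
  ≁0 0<x x<n e with ~⇒≡ x<n 0<n e
  ... | refl = <-irrefl refl 0<x

  m+[n∸m%n]≡[1+m/n]*n : ∀ t → t + (n ∸ t % n) ≡ suc (t / n) * n
  m+[n∸m%n]≡[1+m/n]*n t = begin
    t + (n ∸ t % n)                   ≡⟨ cong (_+ (n ∸ t % n)) (trans (m≡m%n+[m/n]*n t n) (+-comm (t % n) _)) ⟩
    t / n * n + t % n + (n ∸ t % n)   ≡⟨ +-assoc (t / n * n) (t % n) _ ⟩
    t / n * n + (t % n + (n ∸ t % n)) ≡⟨ cong (t / n * n +_) (m+[n∸m]≡n (<⇒≤ (%n<n t))) ⟩
    t / n * n + n                     ≡⟨ +-comm (t / n * n) n ⟩
    suc (t / n) * n                   ∎
    where open ≡-Reasoning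

  -- Adding n ∸ t % n turns t into a multiple of n.
  +-cancelʳ-~ : ∀ {a b} t → a + t ~ b + t → a ~ b
  +-cancelʳ-~ {a} {b} t e =
    ~-trans (~-sym (+*n~ a (suc (t / n))))
    (~-trans (≡⇒~ (trans (cong (a +_) (sym (m+[n∸m%n]≡[1+m/n]*n t))) (sym (+-assoc a t _))))
    (~-trans (+-~ {c = n ∸ t % n} e ~-refl)
    (~-trans (≡⇒~ (trans (+-assoc b t _) (cong (b +_) (m+[n∸m%n]≡[1+m/n]*n t))))
    (+*n~ b (suc (t / n))))))

  +-cancelˡ-~ : ∀ {a b} t → t + a ~ t + b → a ~ b
  +-cancelˡ-~ {a} {b} t e =
    +-cancelʳ-~ t (~-trans (≡⇒~ (+-comm a t)) (~-trans e (≡⇒~ (+-comm t b))))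

  -- sub i t is the residue of the integer i − t, as it occurs in InP.
  sub : ℕ → ℕ → ℕ
  sub i t = (ℤ.+ i ℤ.- ℤ.+ t) ℤ.%ℕ n

  sub<n : ∀ i t → sub i t < n
  sub<n i t = n%ℕd<d (ℤ.+ i ℤ.- ℤ.+ t) n

  sub%n : ∀ i t → sub i t % n ≡ sub i t
  sub%n i t = m<n⇒m%n≡m (sub<n i t)

  -[1+w]%n+[1+w]~0 : ∀ w → -[1+ w ] ℤ.%ℕ n + suc w ~ 0
  -[1+w]%n+[1+w]~0 w with suc w % n in eq
  ... | zero = mk eq
  ... | suc r = ~-trans (+-~ (~-refl {n ∸ suc r}) 1+w~1+r)
                  (~-trans (≡⇒~ (m∸n+n≡m (<⇒≤ 1+r<n))) n~0)
    where
    1+r<n : suc r < n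
    1+r<n = subst (_< n) eq (%n<n (suc w))
    1+w~1+r : suc w ~ suc r
    1+w~1+r = mk (trans eq (sym (m<n⇒m%n≡m 1+r<n)))

  sub+~ : ∀ i t → sub i t + t ~ i
  sub+~ i zero = ~-trans (≡⇒~ (+-identityʳ _)) (~-trans (%n~ (i + 0)) (≡⇒~ (+-identityʳ i)))
  sub+~ i (suc t) with i <? suc t
  ... | no i≮1+t = ~-trans (+-~ (≡⇒~ sub≡) (~-refl {suc t}))
                     (~-trans (+-~ (%n~ (i ∸ suc t)) (~-refl {suc t})) (≡⇒~ (m∸n+n≡m 1+t≤i)))
    where
    1+t≤i : suc t ≤ i
    1+t≤i = ≮⇒≥ i≮1+t
    sub≡ : sub i (suc t) ≡ (i ∸ suc t) % n
    sub≡ = cong (ℤ._%ℕ n) (ℤ.⊖-≥ 1+t≤i)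
  ... | yes i<1+t =
    ~-trans (≡⇒~ (trans (cong (sub i (suc t) +_) 1+t≡) (sym (+-assoc (sub i (suc t)) (suc w) i))))
      (+-~ (~-trans (≡⇒~ (cong (_+ suc w) sub≡)) (-[1+w]%n+[1+w]~0 w)) (~-refl {i}))
    where
    w = t ∸ i
    i≤t : i ≤ t
    i≤t = ≤-pred i<1+t
    sub≡ : sub i (suc t) ≡ -[1+ w ] ℤ.%ℕ n
    sub≡ = cong (ℤ._%ℕ n) (trans (ℤ.⊖-< i<1+t) (cong (λ z → ℤ.- (ℤ.+ z)) (+-∸-assoc 1 i≤t)))
    1+t≡ : suc t ≡ suc w + i
    1+t≡ = sym (cong suc (m∸n+n≡m i≤t))

  sub-unique : ∀ {i t w} → w < n → w + t ~ i → sub i t ≡ w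
  sub-unique {i} {t} w<n e = ~⇒≡ (sub<n i t) w<n (+-cancelʳ-~ t (~-trans (sub+~ i t) (~-sym e)))

  -- (b + (n ∸ i)) % n is (b − i) mod n, written without truncated subtraction.
  offset⁺ : ∀ {i b t} → i ≤ n → b ~ i + t → t < n → (b + (n ∸ i)) % n ≡ t
  offset⁺ {i} {b} {t} i≤n e t<n =
    ~⇒%≡ t<n (~-trans (+-~ e (~-refl {n ∸ i})) (~-trans (≡⇒~ rearrange) (+n~ t)))
    where
    rearrange : i + t + (n ∸ i) ≡ t + n
    rearrange = trans (cong (_+ (n ∸ i)) (+-comm i t)) (trans (+-assoc t i _) (cong (t +_) (m+[n∸m]≡n i≤n)))

  offset⁻ : ∀ {i b t} → i ≤ n → b + t ~ i → 0 < t → t ≤ n → (b + (n ∸ i)) % n ≡ n ∸ t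
  offset⁻ {i} {b} {t} i≤n e 0<t t≤n = ~⇒%≡ (∸-monoʳ-< 0<t t≤n) (+-cancelʳ-~ t
     (~-trans (≡⇒~ rearrange) (~-trans (+-~ e (~-refl {n ∸ i}))
       (≡⇒~ (trans (m+[n∸m]≡n i≤n) (sym (m∸n+n≡m t≤n)))))))
    where
    rearrange : b + (n ∸ i) + t ≡ b + t + (n ∸ i)
    rearrange = trans (+-assoc b _ t) (trans (cong (b +_) (+-comm (n ∸ i) t)) (sym (+-assoc b t _)))

  offset-suc~ : ∀ i X → i < n → X + (n ∸ i) ~ suc ((X + (n ∸ suc i % n)) % n)
  offset-suc~ i X i<n = +-cancelʳ-~ i
    (~-trans (≡⇒~ (trans (+-assoc X _ i) (cong (X +_) (m∸n+n≡m (<⇒≤ i<n))))) (~-trans (+n~ X) (~-sym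
      (~-trans (+-~ (+-~ (~-refl {1}) (%n~ (X + (n ∸ i')))) (~-refl {i}))
      (~-trans (≡⇒~ (sym (+-suc (X + (n ∸ i')) i)))
      (~-trans (+-~ (~-refl {X + (n ∸ i')}) (~-sym (%n~ (suc i))))
      (~-trans (≡⇒~ (trans (+-assoc X _ i') (cong (X +_) (m∸n+n≡m (<⇒≤ (%n<n (suc i)))))))
      (+n~ X))))))))
    where
    i' = suc i % n

  offset-suc : ∀ i X → i < n →
    (X + (n ∸ i)) % n ≡ 0 ⊎ (X + (n ∸ i)) % n ≡ suc ((X + (n ∸ suc i % n)) % n)
  offset-suc i X i<n with suc ((X + (n ∸ suc i % n)) % n) <? n
  ... | yes lt = inj₂ (~⇒%≡ lt (offset-suc~ i X i<n))
  ... | no ge = inj₁ (~⇒%≡ 0<n (~-trans (offset-suc~ i X i<n) (~-trans (≡⇒~ 1+r≡n) n~0)))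
    where
    1+r≡n : suc ((X + (n ∸ suc i % n)) % n) ≡ n
    1+r≡n = ≤-antisym (%n<n (X + (n ∸ suc i % n))) (≮⇒≥ ge)

  +-%≢ : ∀ {i x} → i < n → 0 < x → x < n → (i + x) % n ≢ i
  +-%≢ {i} {x} i<n 0<x x<n eq = ≁0 0<x x<n (+-cancelˡ-~ i
    (~-trans (mk (trans eq (sym (m<n⇒m%n≡m i<n)))) (≡⇒~ (sym (+-identityʳ i)))))

  pair₀-UEq : ∀ {j b₁ b₂} → j < n → UEq (b₁ , b₂) ((j + 0) % n , sub j 0) → b₁ ≡ j × b₂ ≡ j
  pair₀-UEq {j} j<n (inj₁ (refl , refl)) = ~⇒%≡ j<n (≡⇒~ (+-identityʳ j)) , sub-unique j<n (≡⇒~ (+-identityʳ j))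
  pair₀-UEq {j} j<n (inj₂ (refl , refl)) = sub-unique j<n (≡⇒~ (+-identityʳ j)) , ~⇒%≡ j<n (≡⇒~ (+-identityʳ j))

  pair-sum~ : ∀ i l → (i + l) % n + sub i l ~ i + i
  pair-sum~ i l = ~-trans (+-~ (%n~ (i + l)) (~-refl {sub i l}))
    (~-trans (≡⇒~ (trans (+-assoc i l _) (cong (i +_) (+-comm l (sub i l))))) (+-~ (~-refl {i}) (sub+~ i l)))

  pair-sum~-UEq : ∀ {i l a₁ a₂} → UEq (a₁ , a₂) ((i + l) % n , sub i l) → a₁ + a₂ ~ i + i
  pair-sum~-UEq {i} {l} (inj₁ (refl , refl)) = pair-sum~ i l
  pair-sum~-UEq {i} {l} (inj₂ (refl , refl)) = ~-trans (≡⇒~ (+-comm (sub i l) _)) (pair-sum~ i l)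

-- The matchings for odd c = 2h + 1 and d = 2g + 1, where m = cg + h + 1

module OddGrid (h g : ℕ) where
  c : ℕ
  c = suc (h + h)

  d : ℕ
  d = suc (g + g)

  m : ℕ
  m = suc (h + c * g)

  module C = Congruence (h + h)
  module D = Congruence (g + g)
  open C using () renaming (_~_ to _~c_)
  open D using () renaming (_~_ to _~d_)

  ⌊2n+2/2⌋≡n+1 : ∀ n → ⌊ suc (n + n) + 1 /2⌋ ≡ suc n
  ⌊2n+2/2⌋≡n+1 n = trans (cong ⌊_/2⌋ (2n+2≡ n)) (sym (n≡⌊n+n/2⌋ (suc n)))
    where
    2n+2≡ : ∀ n → suc (n + n) + 1 ≡ suc n + suc n
    2n+2≡ = solve-∀

  ⌊c+1/2⌋≡h+1 : ⌊ c + 1 /2⌋ ≡ suc h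
  ⌊c+1/2⌋≡h+1 = ⌊2n+2/2⌋≡n+1 h

  ⌊c∸1/2⌋≡h : ⌊ c ∸ 1 /2⌋ ≡ h
  ⌊c∸1/2⌋≡h = sym (n≡⌊n+n/2⌋ h)

  ⌊d+1/2⌋≡g+1 : ⌊ d + 1 /2⌋ ≡ suc g
  ⌊d+1/2⌋≡g+1 = ⌊2n+2/2⌋≡n+1 g

  ≤h⇒<⌊c+1/2⌋ : ∀ {l} → l ≤ h → l < ⌊ c + 1 /2⌋
  ≤h⇒<⌊c+1/2⌋ l≤h = subst (_ <_) (sym ⌊c+1/2⌋≡h+1) (s≤s l≤h)

  ≤g⇒<⌊d+1/2⌋ : ∀ {l} → l ≤ g → l < ⌊ d + 1 /2⌋
  ≤g⇒<⌊d+1/2⌋ l≤g = subst (_ <_) (sym ⌊d+1/2⌋≡g+1) (s≤s l≤g)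

  ≤h⇒<c : ∀ {x} → x ≤ h → x < c
  ≤h⇒<c x≤h = s≤s (≤-trans x≤h (m≤m+n h h))

  ≤g⇒<d : ∀ {y} → y ≤ g → y < d
  ≤g⇒<d y≤g = s≤s (≤-trans y≤g (m≤m+n g g))

  edge∞ : ℕ → ℕ → Edge
  edge∞ i j = v∞ , vert c d (ℤ.+ i) (ℤ.+ j)

  edgeRow : ℕ → ℕ → ℕ → Edge
  edgeRow i j x = vert c d (ℤ.+ i ℤ.+ ℤ.+ x) (ℤ.+ j) , vert c d (ℤ.+ i ℤ.- ℤ.+ x) (ℤ.+ j)

  edgeDiag : ℕ → ℕ → ℕ → ℕ → Edge
  edgeDiag i j x y = vert c d (ℤ.+ i ℤ.+ ℤ.+ (2 * x)) (ℤ.+ j ℤ.+ ℤ.+ y) ,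
                     vert c d (ℤ.+ i ℤ.- ℤ.+ (2 * x)) (ℤ.+ j ℤ.- ℤ.+ y)

  -- The three clauses of Ord with the floors evaluated; Labelled i j e k is ℓ_{i,j}(e) = k
  -- for e in the orientation written in the paper.
  data Labelled (i j : ℕ) : Edge → ℕ → Set where
    label∞   : Labelled i j (edge∞ i j) 0
    labelRow : ∀ x → 0 < x → x ≤ h → Labelled i j (edgeRow i j x) x
    labelDiag : ∀ x y → x < c → 0 < y → y ≤ g →
                Labelled i j (edgeDiag i j x y) ((y ∸ 1) * c + suc h + (x + i * h) % c)

  HasLabel : ℕ → ℕ → Edge → ℕ → Set
  HasLabel i j e k = Σ Edge λ P → Labelled i j P k × UEq e P

  diagLabel≡ : ∀ i x y → (y ∸ 1) * c + ⌊ c + 1 /2⌋ + ((x + i * ⌊ c ∸ 1 /2⌋) modN c)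
                         ≡ (y ∸ 1) * c + suc h + (x + i * h) % c
  diagLabel≡ i x y = cong₂ (λ p q → (y ∸ 1) * c + p + (x + i * q) % c) ⌊c+1/2⌋≡h+1 ⌊c∸1/2⌋≡h

  Ord⇒HasLabel : ∀ {i j e k} → Ord c d i j e k → HasLabel i j e k
  Ord⇒HasLabel {i} {j} (inj₁ (u , refl)) = edge∞ i j , label∞ , u
  Ord⇒HasLabel {i} {j} (inj₂ (inj₁ (x , 0<x , x< , u , refl))) =
    edgeRow i j x , labelRow x 0<x (≤-pred (subst (x <_) ⌊c+1/2⌋≡h+1 x<)) , u
  Ord⇒HasLabel {i} {j} (inj₂ (inj₂ (x , y , x<c , 0<y , y< , u , refl))) =
    edgeDiag i j x y ,
    subst (Labelled i j _) (sym (diagLabel≡ i x y)) (labelDiag x y x<c 0<y (≤-pred (subst (y <_) ⌊d+1/2⌋≡g+1 y<))) ,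
    u

  HasLabel⇒Ord : ∀ {i j e k} → HasLabel i j e k → Ord c d i j e k
  HasLabel⇒Ord (_ , label∞ , u) = inj₁ (u , refl)
  HasLabel⇒Ord (_ , labelRow x 0<x x≤h , u) = inj₂ (inj₁ (x , 0<x , ≤h⇒<⌊c+1/2⌋ x≤h , u , refl))
  HasLabel⇒Ord {i} (_ , labelDiag x y x<c 0<y y≤g , u) =
    inj₂ (inj₂ (x , y , x<c , 0<y , ≤g⇒<⌊d+1/2⌋ y≤g , u , sym (diagLabel≡ i x y)))

  colOffset : ℕ → ℕ → ℕ
  colOffset i a = (a + (c ∸ i)) % c

  -- h + 1 and h are the inverses of 2 and −2 modulo c, so the upper endpoint
  -- column i + 2x and the lower endpoint column i − 2x both recover x + i h.
  labelAt : ℕ → ℕ → ℕ → ℕ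
  labelAt i a zero = colOffset i a ⊓ (c ∸ colOffset i a)
  labelAt i a (suc y) with suc y ≤? g
  ... | yes _ = y * c + suc h + (a * suc h + (c ∸ i)) % c
  ... | no _ = (d ∸ suc y ∸ 1) * c + suc h + (a * h) % c

  vertexLabel : ℕ → ℕ → Vtx → ℕ
  vertexLabel i j v∞ = 0
  vertexLabel i j (vv a b) = labelAt i a ((b + (d ∸ j)) % d)

  labelAt-upper : ∀ i a y → suc y ≤ g → labelAt i a (suc y) ≡ y * c + suc h + (a * suc h + (c ∸ i)) % c
  labelAt-upper i a y 1+y≤g with suc y ≤? g
  ... | yes _ = refl
  ... | no 1+y≰g = ⊥-elim (1+y≰g 1+y≤g)

  labelAt-lower : ∀ i a y → g < y → labelAt i a y ≡ (d ∸ y ∸ 1) * c + suc h + (a * h) % c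
  labelAt-lower i a (suc y) g<1+y with suc y ≤? g
  ... | yes 1+y≤g = ⊥-elim (<-irrefl refl (<-≤-trans g<1+y 1+y≤g))
  ... | no _ = refl

  upperDiag~ : ∀ i x → i ≤ c → (i + 2 * x) % c * suc h + (c ∸ i) ~c x + i * h
  upperDiag~ i x i≤c =
    C.~-trans (C.+-~ (C.*-~ (C.%n~ (i + 2 * x)) (C.~-refl {suc h})) (C.~-refl {c ∸ i}))
      (C.+-cancelʳ-~ i (C.~-trans (C.≡⇒~ expand) (C.+*n~ (x + i * h + i) (suc x))))
    where
    identity : ∀ i x h → (i + 2 * x) * suc h + suc (h + h) ≡ x + i * h + i + suc x * suc (h + h)
    identity = solve-∀
    expand : (i + 2 * x) * suc h + (c ∸ i) + i ≡ x + i * h + i + suc x * c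
    expand = trans (+-assoc _ (c ∸ i) i)
               (trans (cong ((i + 2 * x) * suc h +_) (m∸n+n≡m i≤c)) (identity i x h))

  lowerDiag~ : ∀ i x → C.sub i (2 * x) * h ~c x + i * h
  lowerDiag~ i x =
    C.~-trans (C.~-sym (C.+*n~ (s * h) x)) (C.~-trans (C.≡⇒~ (identity s x h))
      (C.~-trans (C.+-~ (C.*-~ (C.sub+~ i (2 * x)) (C.~-refl {h})) (C.~-refl {x})) (C.≡⇒~ (+-comm (i * h) x))))
    where
    s = C.sub i (2 * x)
    identity : ∀ s x h → s * h + x * suc (h + h) ≡ (s + 2 * x) * h + x
    identity = solve-∀

  ≤h⇒≤c∸ : ∀ {x} → x ≤ h → x ≤ c ∸ x
  ≤h⇒≤c∸ {x} x≤h = begin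
    x           ≤⟨ x≤h ⟩
    h           ≤⟨ n≤1+n h ⟩
    suc h       ≡⟨ m+n∸n≡m (suc h) h ⟨
    c ∸ h       ≤⟨ ∸-monoʳ-≤ c x≤h ⟩
    c ∸ x       ∎
    where open ≤-Reasoning

  rowOffset-self : ∀ j → j < d → (j % d + (d ∸ j)) % d ≡ 0
  rowOffset-self j j<d = D.offset⁺ (<⇒≤ j<d) (D.~-trans (D.%n~ j) (D.≡⇒~ (sym (+-identityʳ j)))) D.0<n

  vertexLabel-edge∞ : ∀ {i j} → i < c → j < d → vertexLabel i j (proj₂ (edge∞ i j)) ≡ 0
  vertexLabel-edge∞ {i} {j} i<c j<d =
    trans (cong (labelAt i (i % c)) (rowOffset-self j j<d)) (cong (λ r → r ⊓ (c ∸ r)) colOffset≡0)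
    where
    colOffset≡0 : colOffset i (i % c) ≡ 0
    colOffset≡0 = C.offset⁺ (<⇒≤ i<c) (C.~-trans (C.%n~ i) (C.≡⇒~ (sym (+-identityʳ i)))) C.0<n

  vertexLabel-edgeRow : ∀ {i j x} → i < c → j < d → 0 < x → x ≤ h →
    vertexLabel i j (proj₁ (edgeRow i j x)) ≡ x × vertexLabel i j (proj₂ (edgeRow i j x)) ≡ x
  vertexLabel-edgeRow {i} {j} {x} i<c j<d 0<x x≤h =
      trans (cong (labelAt i ((i + x) % c)) (rowOffset-self j j<d))
        (trans (cong (λ r → r ⊓ (c ∸ r)) colOffset⁺) (m≤n⇒m⊓n≡m (≤h⇒≤c∸ x≤h)))
    , trans (cong (labelAt i (C.sub i x)) (rowOffset-self j j<d))
        (trans (cong (λ r → r ⊓ (c ∸ r)) colOffset⁻)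
          (trans (cong ((c ∸ x) ⊓_) (m∸[m∸n]≡n x≤c)) (m≥n⇒m⊓n≡n (≤h⇒≤c∸ x≤h))))
    where
    x≤c : x ≤ c
    x≤c = <⇒≤ (≤h⇒<c x≤h)
    colOffset⁺ : colOffset i ((i + x) % c) ≡ x
    colOffset⁺ = C.offset⁺ (<⇒≤ i<c) (C.%n~ (i + x)) (≤h⇒<c x≤h)
    colOffset⁻ : colOffset i (C.sub i x) ≡ c ∸ x
    colOffset⁻ = C.offset⁻ (<⇒≤ i<c) (C.sub+~ i x) 0<x x≤c

  vertexLabel-edgeDiag : ∀ {i j x y} → i < c → j < d → 0 < y → y ≤ g →
    let k = (y ∸ 1) * c + suc h + (x + i * h) % c in
    vertexLabel i j (proj₁ (edgeDiag i j x y)) ≡ k × vertexLabel i j (proj₂ (edgeDiag i j x y)) ≡ k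
  vertexLabel-edgeDiag {i} {j} {x} {suc y₀} i<c j<d 0<y y≤g =
      trans (cong (labelAt i ((i + 2 * x) % c)) rowOffset⁺)
        (trans (labelAt-upper i _ y₀ y≤g) (cong (y₀ * c + suc h +_) (C.un (upperDiag~ i x (<⇒≤ i<c)))))
    , trans (cong (labelAt i (C.sub i (2 * x))) rowOffset⁻)
        (trans (labelAt-lower i _ (d ∸ y) g<d∸y)
          (cong₂ (λ p q → (p ∸ 1) * c + suc h + q) (m∸[m∸n]≡n y≤d) (C.un (lowerDiag~ i x))))
    where
    y = suc y₀
    y≤d : y ≤ d
    y≤d = <⇒≤ (≤g⇒<d y≤g)
    rowOffset⁺ : ((j + y) % d + (d ∸ j)) % d ≡ y
    rowOffset⁺ = D.offset⁺ (<⇒≤ j<d) (D.%n~ (j + y)) (≤g⇒<d y≤g)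
    rowOffset⁻ : (D.sub j y + (d ∸ j)) % d ≡ d ∸ y
    rowOffset⁻ = D.offset⁻ (<⇒≤ j<d) (D.sub+~ j y) 0<y y≤d
    g<d∸y : g < d ∸ y
    g<d∸y = ≤-trans (≤-reflexive (sym (m+n∸n≡m (suc g) g))) (∸-monoʳ-≤ d y≤g)

  Labelled⇒vertexLabel : ∀ {i j P k} → i < c → j < d → Labelled i j P k →
    vertexLabel i j (proj₁ P) ≡ k × vertexLabel i j (proj₂ P) ≡ k
  Labelled⇒vertexLabel i<c j<d label∞ = refl , vertexLabel-edge∞ i<c j<d
  Labelled⇒vertexLabel i<c j<d (labelRow x 0<x x≤h) = vertexLabel-edgeRow i<c j<d 0<x x≤h
  Labelled⇒vertexLabel i<c j<d (labelDiag x y _ 0<y y≤g) = vertexLabel-edgeDiag {x = x} i<c j<d 0<y y≤g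

  Ord⇒vertexLabel : ∀ {i j e k} → i < c → j < d → Ord c d i j e k →
    vertexLabel i j (proj₁ e) ≡ k × vertexLabel i j (proj₂ e) ≡ k
  Ord⇒vertexLabel i<c j<d o with Ord⇒HasLabel o
  ... | _ , lab , inj₁ (refl , refl) = Labelled⇒vertexLabel i<c j<d lab
  ... | _ , lab , inj₂ (refl , refl) = swap (Labelled⇒vertexLabel i<c j<d lab)

  Ord-wellDefined : ∀ {i j} → i < c → j < d →
    ∀ e e' k k' → Ord c d i j e k → Ord c d i j e' k' → UEq e e' → k ≡ k'
  Ord-wellDefined i<c j<d _ _ _ _ o o' (inj₁ (refl , refl)) =
    trans (sym (proj₁ (Ord⇒vertexLabel i<c j<d o))) (proj₁ (Ord⇒vertexLabel i<c j<d o'))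
  Ord-wellDefined i<c j<d _ _ _ _ o o' (inj₂ (refl , refl)) =
    trans (sym (proj₁ (Ord⇒vertexLabel i<c j<d o))) (proj₂ (Ord⇒vertexLabel i<c j<d o'))

  disjoint-by-labels : ∀ {p q p' q' k k'} (L L' : Vtx → ℕ) →
    L p ≡ k × L q ≡ k → L' p' ≡ k' × L' q' ≡ k' →
    (∀ u → L u ≡ k → L' u ≡ k' → ⊥) → DisjointEdges (p , q) (p' , q')
  disjoint-by-labels L L' (Lp , Lq) (L'p' , L'q') apart =
      (λ { refl → apart _ Lp L'p' }) , (λ { refl → apart _ Lp L'q' })
    , (λ { refl → apart _ Lq L'p' }) , (λ { refl → apart _ Lq L'q' })

  Ord-disjoint : ∀ {i j e f k k'} → i < c → j < d →
    Ord c d i j e k → Ord c d i j f k' → k ≢ k' → DisjointEdges e f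
  Ord-disjoint {i} {j} {_ , _} {_ , _} i<c j<d o o' k≢k' =
    disjoint-by-labels (vertexLabel i j) (vertexLabel i j)
      (Ord⇒vertexLabel i<c j<d o) (Ord⇒vertexLabel i<c j<d o') (λ _ Lu≡k Lu≡k' → k≢k' (trans (sym Lu≡k) Lu≡k'))

  labelAt-suc : ∀ i a y → i < c → labelAt i a y ≤ suc (labelAt (suc i % c) a y)
  labelAt-suc i a zero i<c with C.offset-suc i a i<c
  ... | inj₁ e rewrite e = z≤n
  ... | inj₂ e rewrite e =
    ⊓-mono-≤ (≤-refl {suc r}) (≤-trans (∸-monoʳ-≤ c (n≤1+n r)) (n≤1+n _))
    where r = colOffset (suc i % c) a
  labelAt-suc i a (suc y) i<c with suc y ≤? g
  ... | no _ = n≤1+n _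
  ... | yes _ with C.offset-suc i (a * suc h) i<c
  ...   | inj₁ e rewrite e = ≤-trans (≤-reflexive (+-identityʳ _)) (≤-trans (m≤m+n _ _) (n≤1+n _))
  ...   | inj₂ e rewrite e = ≤-reflexive (+-suc _ _)

  vertexLabel-suc : ∀ i j u → i < c → vertexLabel i j u ≤ suc (vertexLabel (suc i % c) j u)
  vertexLabel-suc i j v∞ i<c = z≤n
  vertexLabel-suc i j (vv a b) i<c = labelAt-suc i a ((b + (d ∸ j)) % d) i<c

  Ord-suc-disjoint : ∀ {i j e f p q} → i < c → j < d →
    Ord c d i j e p → Ord c d (suc i % c) j f q → suc (suc q) ≤ p → DisjointEdges e f
  Ord-suc-disjoint {i} {j} {_ , _} {_ , _} i<c j<d o o' 2+q≤p =
    disjoint-by-labels (vertexLabel i j) (vertexLabel (suc i % c) j)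
      (Ord⇒vertexLabel i<c j<d o) (Ord⇒vertexLabel (C.%n<n (suc i)) j<d o')
      (λ u Lu≡p L'u≡q → <-irrefl refl (≤-trans (s≤s (subst₂ (λ x y → x ≤ suc y) Lu≡p L'u≡q (vertexLabel-suc i j u i<c))) 2+q≤p))

  diagLabel≥ : ∀ q r → suc h ≤ q * c + suc h + r
  diagLabel≥ q r = ≤-trans (m≤n+m (suc h) (q * c)) (m≤m+n _ r)

  divMod-injective : ∀ q q' r r' s → r < c → r' < c →
    q * c + s + r ≡ q' * c + s + r' → q ≡ q' × r ≡ r'
  divMod-injective q q' r r' s r<c r'<c eq =
    *-cancelʳ-≡ q q' c (+-cancelˡ-≡ r _ _ (trans r+qc≡ (cong (_+ q' * c) (sym r≡r')))) , r≡r'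
    where
    rearrange : ∀ a s r → a + s + r ≡ s + (r + a)
    rearrange = solve-∀
    r+qc≡ : r + q * c ≡ r' + q' * c
    r+qc≡ = +-cancelˡ-≡ s _ _ (trans (sym (rearrange (q * c) s r)) (trans eq (rearrange (q' * c) s r')))
    r≡r' : r ≡ r'
    r≡r' = C.~⇒≡ r<c r'<c (C.~-trans (C.~-sym (C.+*n~ r q)) (C.~-trans (C.≡⇒~ r+qc≡) (C.+*n~ r' q')))

  Labelled-injective : ∀ {i j P P' k k'} → Labelled i j P k → Labelled i j P' k' → k ≡ k' → P ≡ P'
  Labelled-injective label∞ label∞ _ = refl
  Labelled-injective label∞ (labelRow x 0<x _) eq = ⊥-elim (<-irrefl eq 0<x)
  Labelled-injective {i} label∞ (labelDiag x y _ _ _) eq =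
    ⊥-elim (<-irrefl eq (<-≤-trans z<s (diagLabel≥ (y ∸ 1) ((x + i * h) % c))))
  Labelled-injective (labelRow x 0<x _) label∞ eq = ⊥-elim (<-irrefl (sym eq) 0<x)
  Labelled-injective (labelRow x _ _) (labelRow .x _ _) refl = refl
  Labelled-injective {i} (labelRow x _ x≤h) (labelDiag x' y _ _ _) eq =
    ⊥-elim (<-irrefl eq (<-≤-trans (s≤s x≤h) (diagLabel≥ (y ∸ 1) ((x' + i * h) % c))))
  Labelled-injective {i} (labelDiag x y _ _ _) label∞ eq =
    ⊥-elim (<-irrefl (sym eq) (<-≤-trans z<s (diagLabel≥ (y ∸ 1) ((x + i * h) % c))))
  Labelled-injective {i} (labelDiag x' y _ _ _) (labelRow x _ x≤h) eq =
    ⊥-elim (<-irrefl (sym eq) (<-≤-trans (s≤s x≤h) (diagLabel≥ (y ∸ 1) ((x' + i * h) % c))))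
  Labelled-injective {i} {j} (labelDiag x (suc y) x<c _ _) (labelDiag x' (suc y') x'<c _ _) eq
    with divMod-injective y y' _ _ (suc h) (C.%n<n (x + i * h)) (C.%n<n (x' + i * h)) eq
  ... | y≡y' , x+ih≡ = cong₂ (edgeDiag i j) (C.~⇒≡ x<c x'<c (C.+-cancelʳ-~ (i * h) (C.mk x+ih≡))) (cong suc y≡y')

  Labelled-bounded : ∀ {i j P k} → Labelled i j P k → k < m
  Labelled-bounded label∞ = s≤s z≤n
  Labelled-bounded (labelRow x _ x≤h) = s≤s (≤-trans x≤h (m≤m+n h (c * g)))
  Labelled-bounded {i} (labelDiag x (suc y) x<c _ 1+y≤g) = s≤s (begin
    y * c + suc h + r   ≡⟨ rearrange (y * c) h r ⟩
    h + suc (y * c + r) ≤⟨ +-monoʳ-≤ h (+-monoʳ-< (y * c) (C.%n<n (x + i * h))) ⟩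
    h + (y * c + c)     ≡⟨ cong (h +_) (+-comm (y * c) c) ⟩
    h + suc y * c       ≤⟨ +-monoʳ-≤ h (*-monoˡ-≤ c 1+y≤g) ⟩
    h + g * c           ≡⟨ cong (h +_) (*-comm g c) ⟩
    h + c * g           ∎)
    where
    open ≤-Reasoning
    r = (x + i * h) % c
    rearrange : ∀ a h r → a + suc h + r ≡ h + suc (a + r)
    rearrange = solve-∀

  -- A label k > h is written k = (h + 1) + y c + r with r < c, and x is chosen with x + i h ≡ r.
  Labelled-surjective : ∀ i j k → k < m → Σ Edge λ P → Labelled i j P k
  Labelled-surjective i j zero _ = edge∞ i j , label∞
  Labelled-surjective i j (suc k₀) k<m with suc k₀ ≤? h
  ... | yes k≤h = edgeRow i j (suc k₀) , labelRow (suc k₀) z<s k≤h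
  ... | no k≰h = edgeDiag i j x (suc y) , subst (Labelled i j _) label≡ (labelDiag x (suc y) (C.%n<n (r + (c ∸ i * h % c))) z<s 1+y≤g)
    where
    k = suc k₀
    n = k ∸ suc h
    k≡ : k ≡ suc h + n
    k≡ = sym (m+[n∸m]≡n (≰⇒> k≰h))
    n<cg : n < c * g
    n<cg = +-cancelˡ-≤ h (suc n) (c * g) (subst (_≤ h + c * g) (trans k≡ (sym (+-suc h n))) (≤-pred k<m))
    y = n / c
    1+y≤g : suc y ≤ g
    1+y≤g = m<n*o⇒m/o<n (subst (n <_) (*-comm c g) n<cg)
    r = n % c
    x = (r + (c ∸ i * h % c)) % c
    x+ih≡r : (x + i * h) % c ≡ r
    x+ih≡r = C.~⇒%≡ (C.%n<n n)
      (C.~-trans (C.+-~ (C.%n~ (r + (c ∸ i * h % c))) (C.~-sym (C.%n~ (i * h))))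
      (C.~-trans (C.≡⇒~ (trans (+-assoc r _ _) (cong (r +_) (m∸n+n≡m (<⇒≤ (C.%n<n (i * h)))))))
      (C.+n~ r)))
    rearrange : ∀ a s r → a + s + r ≡ s + (r + a)
    rearrange = solve-∀
    label≡ : y * c + suc h + (x + i * h) % c ≡ k
    label≡ = trans (cong (y * c + suc h +_) x+ih≡r)
               (trans (rearrange (y * c) (suc h) r) (trans (cong (suc h +_) (sym (m≡m%n+[m/n]*n n c))) (sym k≡)))

  edgeRow∈M : ∀ {i j x} → i < c → j < d → 0 < x → x ≤ h → InM c d i j (edgeRow i j x)
  edgeRow∈M {i} {j} {x} i<c j<d 0<x x≤h =
    inj₂ ((i + x) % c , C.sub i x , (j + 0) % d , D.sub j 0 ,
          (x , ≤h⇒<⌊c+1/2⌋ x≤h , UEq-refl) , (0 , ≤g⇒<⌊d+1/2⌋ z≤n , UEq-refl) ,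
          inj₁ (C.+-%≢ i<c 0<x (≤h⇒<c x≤h)) , UEq-reflexive (cong₂ _,_ upper lower))
    where
    j≡ : j % d ≡ (j + 0) % d % d
    j≡ = sym (trans (m%n%n≡m%n (j + 0) d) (cong (_% d) (+-identityʳ j)))
    upper : vv ((i + x) % c) (j % d) ≡ vv ((i + x) % c % c) ((j + 0) % d % d)
    upper = cong₂ vv (sym (m%n%n≡m%n (i + x) c)) j≡
    lower : vv (C.sub i x) (j % d) ≡ vv (C.sub i x % c) (D.sub j 0 % d)
    lower = cong₂ vv (sym (C.sub%n i x)) j≡

  edgeDiag∈M-near : ∀ {i j x y} → j < d → 0 < y → y ≤ g → 2 * x % c ≤ h → InM c d i j (edgeDiag i j x y)
  edgeDiag∈M-near {i} {j} {x} {y} j<d 0<y y≤g t≤h =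
    inj₂ ((i + t) % c , C.sub i t , (j + y) % d , D.sub j y ,
          (t , ≤h⇒<⌊c+1/2⌋ t≤h , UEq-refl) , (y , ≤g⇒<⌊d+1/2⌋ y≤g , UEq-refl) ,
          inj₂ (D.+-%≢ j<d 0<y (≤g⇒<d y≤g)) , UEq-reflexive (cong₂ _,_ upper lower))
    where
    t = 2 * x % c
    upper : vv ((i + 2 * x) % c) ((j + y) % d) ≡ vv ((i + t) % c % c) ((j + y) % d % d)
    upper = cong₂ vv (C.un (C.~-trans (C.+-~ (C.~-refl {i}) (C.~-sym (C.%n~ (2 * x)))) (C.~-sym (C.%n~ (i + t)))))
                     (sym (m%n%n≡m%n (j + y) d))
    lower : vv (C.sub i (2 * x)) (D.sub j y) ≡ vv (C.sub i t % c) (D.sub j y % d)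
    lower = cong₂ vv (trans (sym (C.sub-unique (C.sub<n i (2 * x))
                       (C.~-trans (C.+-~ (C.~-refl {C.sub i (2 * x)}) (C.%n~ (2 * x))) (C.sub+~ i (2 * x)))))
                       (sym (C.sub%n i t)))
                     (sym (D.sub%n j y))

  -- When 2x mod c > h the column pair {i + 2x, i − 2x} is listed in P_{i,c} as {i − l, i + l}, l = c − 2x mod c.
  edgeDiag∈M-far : ∀ {i j x y} → j < d → 0 < y → y ≤ g → h < 2 * x % c → InM c d i j (edgeDiag i j x y)
  edgeDiag∈M-far {i} {j} {x} {y} j<d 0<y y≤g h<t =
    inj₂ (C.sub i l , (i + l) % c , (j + y) % d , D.sub j y ,
          (l , ≤h⇒<⌊c+1/2⌋ l≤h , UEq-swap) , (y , ≤g⇒<⌊d+1/2⌋ y≤g , UEq-refl) ,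
          inj₂ (D.+-%≢ j<d 0<y (≤g⇒<d y≤g)) , UEq-reflexive (cong₂ _,_ upper lower))
    where
    t = 2 * x % c
    l = c ∸ t
    t≤c : t ≤ c
    t≤c = <⇒≤ (C.%n<n (2 * x))
    l≤h : l ≤ h
    l≤h = ≤-trans (∸-monoʳ-≤ c h<t) (≤-reflexive (m+n∸n≡m h h))
    i+2x~ : i + 2 * x ~c C.sub i l
    i+2x~ = C.~-sym (C.~-trans (C.~-sym (C.+n~ (C.sub i l)))
      (C.~-trans (C.≡⇒~ (trans (cong (C.sub i l +_) (sym (m∸n+n≡m t≤c))) (sym (+-assoc (C.sub i l) l t))))
      (C.~-trans (C.+-~ (C.sub+~ i l) (C.~-refl {t})) (C.+-~ (C.~-refl {i}) (C.%n~ (2 * x))))))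
    upper : vv ((i + 2 * x) % c) ((j + y) % d) ≡ vv (C.sub i l % c) ((j + y) % d % d)
    upper = cong₂ vv (trans (C.~⇒%≡ (C.sub<n i l) i+2x~) (sym (C.sub%n i l))) (sym (m%n%n≡m%n (j + y) d))
    i+l+2x~ : (i + l) % c % c + 2 * x ~c i
    i+l+2x~ = C.~-trans (C.+-~ (C.~-trans (C.%n~ ((i + l) % c)) (C.%n~ (i + l))) (C.~-sym (C.%n~ (2 * x))))
      (C.~-trans (C.≡⇒~ (trans (+-assoc i l t) (cong (i +_) (m∸n+n≡m t≤c)))) (C.+n~ i))
    lower : vv (C.sub i (2 * x)) (D.sub j y) ≡ vv ((i + l) % c % c) (D.sub j y % d)
    lower = cong₂ vv (C.sub-unique (C.%n<n ((i + l) % c)) i+l+2x~) (sym (D.sub%n j y))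

  Labelled⇒InM : ∀ {i j P k} → i < c → j < d → Labelled i j P k → InM c d i j P
  Labelled⇒InM _ _ label∞ = inj₁ UEq-refl
  Labelled⇒InM i<c j<d (labelRow x 0<x x≤h) = edgeRow∈M i<c j<d 0<x x≤h
  Labelled⇒InM _ j<d (labelDiag x y _ 0<y y≤g) with 2 * x % c ≤? h
  ... | yes t≤h = edgeDiag∈M-near {x = x} j<d 0<y y≤g t≤h
  ... | no t≰h = edgeDiag∈M-far {x = x} j<d 0<y y≤g (≰⇒> t≰h)

  InM-resp-UEq : ∀ {i j e P} → UEq e P → InM c d i j P → InM c d i j e
  InM-resp-UEq u (inj₁ u') = inj₁ (UEq-trans u u')
  InM-resp-UEq u (inj₂ (a₁ , a₂ , b₁ , b₂ , pa , pb , ne , u')) = inj₂ (a₁ , a₂ , b₁ , b₂ , pa , pb , ne , UEq-trans u u')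

  diagIndex : ℕ → ℕ → ℕ
  diagIndex α i = (α + (c ∸ i)) * suc h % c

  2*diagIndex~ : ∀ α i → 2 * diagIndex α i ~c α + (c ∸ i)
  2*diagIndex~ α i = C.~-trans (C.*-~ (C.~-refl {2}) (C.%n~ ((α + (c ∸ i)) * suc h)))
    (C.~-trans (C.≡⇒~ (identity (α + (c ∸ i)) h)) (C.+*n~ (α + (c ∸ i)) (α + (c ∸ i))))
    where
    identity : ∀ z h → 2 * (z * suc h) ≡ z + z * suc (h + h)
    identity = solve-∀

  edgeDiag≡ : ∀ {i j y α β B₁ B₂} → i < c → α + β ~c i + i → B₁ ~d j + y → B₂ + y ~d j →
    (vv (α % c) (B₁ % d) , vv (β % c) (B₂ % d)) ≡ edgeDiag i j (diagIndex α i) y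
  edgeDiag≡ {i} {j} {y} {α} {β} {B₁} {B₂} i<c α+β~ B₁~ B₂+y~ =
    cong₂ _,_ (cong₂ vv upperCol (D.un B₁~)) (cong₂ vv lowerCol lowerRow)
    where
    rearrange : ∀ a b z → a + (b + z) ≡ b + (a + z)
    rearrange = solve-∀
    i+[c∸i]≡c : i + (c ∸ i) ≡ c
    i+[c∸i]≡c = m+[n∸m]≡n (<⇒≤ i<c)
    upperCol : α % c ≡ (i + 2 * diagIndex α i) % c
    upperCol = C.un (C.~-sym (C.~-trans (C.+-~ (C.~-refl {i}) (2*diagIndex~ α i))
      (C.~-trans (C.≡⇒~ (trans (rearrange i α (c ∸ i)) (cong (α +_) i+[c∸i]≡c))) (C.+n~ α))))
    lowerCol : β % c ≡ C.sub i (2 * diagIndex α i)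
    lowerCol = sym (C.sub-unique (C.%n<n β) (C.~-trans (C.+-~ (C.%n~ β) (2*diagIndex~ α i))
      (C.~-trans (C.≡⇒~ (trans (rearrange β α (c ∸ i)) (sym (+-assoc α β _))))
      (C.~-trans (C.+-~ α+β~ (C.~-refl {c ∸ i}))
      (C.~-trans (C.≡⇒~ (trans (+-assoc i i _) (cong (i +_) i+[c∸i]≡c))) (C.+n~ i))))))
    lowerRow : B₂ % d ≡ D.sub j y
    lowerRow = sym (D.sub-unique (D.%n<n B₂) (D.~-trans (D.+-~ (D.%n~ B₂) (D.~-refl {y})) B₂+y~))

  diagPair⇒HasLabel : ∀ {i j y a₁ a₂ b₁ b₂ e} → i < c → 0 < y → y ≤ g → a₁ + a₂ ~c i + i →
    UEq e (vv (a₁ % c) (b₁ % d) , vv (a₂ % c) (b₂ % d)) → UEq (b₁ , b₂) ((j + y) % d , D.sub j y) →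
    ∃[ k ] HasLabel i j e k
  diagPair⇒HasLabel {i} {j} {y} {a₁} {a₂} i<c 0<y y≤g a₁+a₂~ u (inj₁ (refl , refl)) =
    _ , edgeDiag i j (diagIndex a₁ i) y , labelDiag (diagIndex a₁ i) y (C.%n<n ((a₁ + (c ∸ i)) * suc h)) 0<y y≤g ,
    UEq-trans u (UEq-reflexive (edgeDiag≡ {α = a₁} {β = a₂} i<c a₁+a₂~ (D.%n~ (j + y)) (D.sub+~ j y)))
  diagPair⇒HasLabel {i} {j} {y} {a₁} {a₂} i<c 0<y y≤g a₁+a₂~ u (inj₂ (refl , refl)) =
    _ , edgeDiag i j (diagIndex a₂ i) y , labelDiag (diagIndex a₂ i) y (C.%n<n ((a₂ + (c ∸ i)) * suc h)) 0<y y≤g ,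
    UEq-trans u (UEq-trans UEq-swap
      (UEq-reflexive (edgeDiag≡ {α = a₂} {β = a₁} i<c (C.~-trans (C.≡⇒~ (+-comm a₂ a₁)) a₁+a₂~) (D.%n~ (j + y)) (D.sub+~ j y))))

  rowPair⇒HasLabel : ∀ {i j l a₁ a₂ b₁ b₂ e} → 0 < l → l ≤ h → b₁ ≡ j → b₂ ≡ j →
    UEq e (vv (a₁ % c) (b₁ % d) , vv (a₂ % c) (b₂ % d)) → UEq (a₁ , a₂) ((i + l) % c , C.sub i l) →
    ∃[ k ] HasLabel i j e k
  rowPair⇒HasLabel {i} {j} {l} 0<l l≤h refl refl u (inj₁ (refl , refl)) =
    l , edgeRow i j l , labelRow l 0<l l≤h , UEq-trans u (UEq-reflexive edge≡)
    where
    edge≡ : (vv ((i + l) % c % c) (j % d) , vv (C.sub i l % c) (j % d)) ≡ edgeRow i j l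
    edge≡ = cong₂ _,_ (cong (λ a → vv a (j % d)) (m%n%n≡m%n (i + l) c)) (cong (λ a → vv a (j % d)) (C.sub%n i l))
  rowPair⇒HasLabel {i} {j} {l} 0<l l≤h refl refl u (inj₂ (refl , refl)) =
    l , edgeRow i j l , labelRow l 0<l l≤h , UEq-trans u (UEq-trans UEq-swap (UEq-reflexive edge≡))
    where
    edge≡ : (vv ((i + l) % c % c) (j % d) , vv (C.sub i l % c) (j % d)) ≡ edgeRow i j l
    edge≡ = cong₂ _,_ (cong (λ a → vv a (j % d)) (m%n%n≡m%n (i + l) c)) (cong (λ a → vv a (j % d)) (C.sub%n i l))

  InM⇒HasLabel : ∀ {i j e} → i < c → j < d → InM c d i j e → ∃[ k ] HasLabel i j e k
  InM⇒HasLabel {i} {j} _ _ (inj₁ u) = 0 , edge∞ i j , label∞ , u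
  InM⇒HasLabel {i} {j} i<c j<d (inj₂ (a₁ , a₂ , _ , _ , (l , _ , ua) , (suc y , y< , ub) , _ , u)) =
    diagPair⇒HasLabel {j = j} {a₁ = a₁} {a₂} i<c z<s (≤-pred (subst (suc y <_) ⌊d+1/2⌋≡g+1 y<)) (C.pair-sum~-UEq {i} {l} ua) u ub
  InM⇒HasLabel i<c j<d (inj₂ (_ , _ , _ , _ , (zero , _ , ua) , (zero , _ , ub) , inj₁ a₁≢i , _)) =
    ⊥-elim (a₁≢i (proj₁ (C.pair₀-UEq i<c ua)))
  InM⇒HasLabel i<c j<d (inj₂ (_ , _ , _ , _ , (zero , _ , _) , (zero , _ , ub) , inj₂ b₁≢j , _)) =
    ⊥-elim (b₁≢j (proj₁ (D.pair₀-UEq j<d ub)))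
  InM⇒HasLabel i<c j<d (inj₂ (_ , _ , _ , _ , (suc l , l< , ua) , (zero , _ , ub) , _ , u)) =
    rowPair⇒HasLabel z<s (≤-pred (subst (suc l <_) ⌊c+1/2⌋≡h+1 l<))
      (proj₁ (D.pair₀-UEq j<d ub)) (proj₂ (D.pair₀-UEq j<d ub)) u ua

  Ord-isOrdering : ∀ i j → i < c → j < d → IsOrdering (InM c d i j) (Ord c d i j) m
  Ord-isOrdering i j i<c j<d = lands , total , Ord-wellDefined i<c j<d , injective , surjective
    where
    lands : ∀ e k → Ord c d i j e k → InM c d i j e × k < m
    lands e k o with Ord⇒HasLabel o
    ... | P , lab , u = InM-resp-UEq u (Labelled⇒InM i<c j<d lab) , Labelled-bounded lab
    total : ∀ e → InM c d i j e → ∃[ k ] Ord c d i j e k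
    total e e∈M with InM⇒HasLabel i<c j<d e∈M
    ... | k , has = k , HasLabel⇒Ord has
    injective : ∀ e e' k → Ord c d i j e k → Ord c d i j e' k → UEq e e'
    injective e e' k o o' with Ord⇒HasLabel o | Ord⇒HasLabel o'
    ... | P , lab , u | P' , lab' , u' =
      UEq-trans u (UEq-trans (UEq-reflexive (Labelled-injective lab lab' refl)) (UEq-sym u'))
    surjective : ∀ k → k < m → ∃[ e ] Ord c d i j e k
    surjective k k<m with Labelled-surjective i j k k<m
    ... | P , lab = P , HasLabel⇒Ord (P , lab , UEq-refl)

  data SymmetricAbout (i : ℕ) : Edge → Set where
    spoke : ∀ {b} → SymmetricAbout i (v∞ , vv (i % c) b)
    pair  : ∀ {a b a' b'} → a + a' ~c i + i → SymmetricAbout i (vv a b , vv a' b')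

  Labelled⇒SymmetricAbout : ∀ {i j P k} → Labelled i j P k → SymmetricAbout i P
  Labelled⇒SymmetricAbout label∞ = spoke
  Labelled⇒SymmetricAbout {i} (labelRow x _ _) = pair (C.pair-sum~ i x)
  Labelled⇒SymmetricAbout {i} (labelDiag x _ _ _ _) = pair (C.pair-sum~ i (2 * x))

  2i≁2[i+1] : ∀ {i} → 1 ≤ h → i + i ~c suc i % c + suc i % c → ⊥
  2i≁2[i+1] {i} 1≤h e = C.≁0 z<s (s≤s (+-mono-≤ 1≤h 1≤h)) (C.~-sym (C.+-cancelˡ-~ (i + i)
    (C.~-trans (C.≡⇒~ (+-identityʳ (i + i))) (C.~-trans e (C.~-trans (C.+-~ (C.%n~ (suc i)) (C.%n~ (suc i)))
      (C.≡⇒~ (trans (cong suc (+-suc i i)) (+-comm 2 (i + i)))))))))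

  -- Both contradictions come from 1 ≢ 0 and 2 ≢ 0 modulo c ≥ 3.
  SymmetricAbout-suc-⊥ : ∀ {i P P'} → 1 ≤ h →
    SymmetricAbout i P → SymmetricAbout (suc i % c) P' → UEq P P' → ⊥
  SymmetricAbout-suc-⊥ {i} 1≤h spoke spoke (inj₁ (refl , eq)) =
    C.≁0 z<s (≤h⇒<c 1≤h) (C.+-cancelˡ-~ i (C.~-trans (C.≡⇒~ (+-comm i 1))
      (C.~-trans (C.~-sym (C.~-trans (C.mk (cong column eq)) (C.%n~ (suc i)))) (C.≡⇒~ (sym (+-identityʳ i))))))
    where
    column : Vtx → ℕ
    column v∞ = 0
    column (vv a _) = a
  SymmetricAbout-suc-⊥ 1≤h (pair s) (pair s') (inj₁ (refl , refl)) = 2i≁2[i+1] 1≤h (C.~-trans (C.~-sym s) s')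
  SymmetricAbout-suc-⊥ 1≤h (pair {a} {_} {a'} s) (pair s') (inj₂ (refl , refl)) =
    2i≁2[i+1] 1≤h (C.~-trans (C.~-sym s) (C.~-trans (C.≡⇒~ (+-comm a a')) s'))
  SymmetricAbout-suc-⊥ _ spoke (pair _) (inj₁ (() , _))
  SymmetricAbout-suc-⊥ _ spoke (pair _) (inj₂ (() , _))
  SymmetricAbout-suc-⊥ _ (pair _) spoke (inj₁ (() , _))
  SymmetricAbout-suc-⊥ _ (pair _) spoke (inj₂ (_ , ()))
  SymmetricAbout-suc-⊥ _ spoke spoke (inj₂ (() , _))

  InM-edgeDisjoint : ∀ i j → 1 ≤ h → i < c → j < d → EdgeDisjointGraphs (InM c d i j) (InM c d (suc i % c) j)
  InM-edgeDisjoint i j 1≤h i<c j<d e e' e∈M e'∈M' e≈e'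
    with InM⇒HasLabel i<c j<d e∈M | InM⇒HasLabel (C.%n<n (suc i)) j<d e'∈M'
  ... | _ , P , lab , u | _ , P' , lab' , u' =
    SymmetricAbout-suc-⊥ 1≤h (Labelled⇒SymmetricAbout lab) (Labelled⇒SymmetricAbout lab')
      (UEq-trans (UEq-sym u) (UEq-trans e≈e' u'))

  Ord-msAtLeast : ∀ i j → i < c → j < d → MsAtLeast m m (Ord c d i j) (Ord c d (suc i % c) j) (m ∸ 1)
  Ord-msAtLeast i j i<c j<d = m ∸ 1 , ≤-refl , ≤-trans (m∸n≤m m 1) (m≤m+n m m) , window
    where
    gap : ∀ {t p k} → t ≤ p → m + k < t + (m ∸ 1) → suc (suc k) ≤ p
    gap {t} {p} {k} t≤p lt = ≤-trans (+-cancelˡ-≤ (h + c * g) (suc (suc k)) t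
      (subst₂ _≤_ (identity (h + c * g) k) (+-comm t (h + c * g)) lt)) t≤p
      where
      identity : ∀ M k → suc (suc (M + k)) ≡ M + suc (suc k)
      identity = solve-∀
    window : WindowProp m m (Ord c d i j) (Ord c d (suc i % c) j) (m ∸ 1)
    window t _ _ _ p q e f _ _ _ _ p≢q (inj₁ (_ , o)) (inj₁ (_ , o')) = Ord-disjoint i<c j<d o o' p≢q
    window t _ _ _ p q e f _ _ _ _ p≢q (inj₂ (k , refl , o)) (inj₂ (k' , refl , o')) =
      Ord-disjoint (C.%n<n (suc i)) j<d o o' (λ k≡k' → p≢q (cong (m +_) k≡k'))
    window t _ _ _ p q e f t≤p _ _ q<t+s _ (inj₁ (_ , o)) (inj₂ (k' , refl , o')) =
      Ord-suc-disjoint i<c j<d o o' (gap t≤p q<t+s)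
    window t _ _ _ p q e f _ p<t+s t≤q _ _ (inj₂ (k , refl , o)) (inj₁ (_ , o')) =
      DisjointEdges-sym (Ord-suc-disjoint i<c j<d o' o (gap t≤q p<t+s))

  lemma23-odd : 1 ≤ h → ∀ i j → i < c → j < d →
    IsOrdering (InM c d i j) (Ord c d i j) m
    × IsOrdering (InM c d (suc i modN c) j) (Ord c d (suc i modN c) j) m
    × EdgeDisjointGraphs (InM c d i j) (InM c d (suc i modN c) j)
    × MsAtLeast m m (Ord c d i j) (Ord c d (suc i modN c) j) (m ∸ 1)
  lemma23-odd 1≤h i j i<c j<d =
    Ord-isOrdering i j i<c j<d , Ord-isOrdering (suc i % c) j (C.%n<n (suc i)) j<d ,
    InM-edgeDisjoint i j 1≤h i<c j<d , Ord-msAtLeast i j i<c j<d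

odd-factorˡ : ∀ a b k → a * b ≡ suc (2 * k) → ∃[ a' ] a ≡ suc (2 * a')
odd-factorˡ a b k eq with a % 2 | m≡m%n+[m/n]*n a 2 | m%n<n a 2
... | zero | a≡ | _ = ⊥-elim (even≢odd (a / 2 * b) k (begin
  2 * (a / 2 * b) ≡⟨ identity (a / 2) b ⟩
  a / 2 * 2 * b   ≡⟨ cong (_* b) a≡ ⟨
  a * b           ≡⟨ eq ⟩
  suc (2 * k)     ∎))
  where
  open ≡-Reasoning
  identity : ∀ t b → 2 * (t * b) ≡ t * 2 * b
  identity = solve-∀
... | suc zero | a≡ | _ = a / 2 , trans a≡ (cong suc (*-comm (a / 2) 2))
... | suc (suc _) | _ | s≤s (s≤s ())

-- d is an odd divisor of N = 2k + 1 and c = N / d; c = 1 would force d = N ≤ r.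
odd-divisor-split : ∀ {N D r k} → N ≡ suc (2 * k) → D ∣ N → D ∣ r → 0 < r → r < N →
  Σ ℕ λ h → Σ ℕ λ g → N divN D ≡ suc (h + h) × D ≡ suc (g + g) × k ≡ h + suc (h + h) * g × 1 ≤ h
odd-divisor-split {D = zero} _ _ D∣r 0<r _ with 0∣⇒≡0 D∣r
... | refl = ⊥-elim (<-irrefl refl 0<r)
odd-divisor-split {N} {D@(suc _)} {r} {k} N≡ D∣N D∣r 0<r r<N =
  split (odd-factorˡ q D k qD≡) (odd-factorˡ D q k (trans (*-comm D q) qD≡))
  where
  q = quotient D∣N
  N≡qD : N ≡ q * D
  N≡qD = m∣n⇒n≡quotient*m D∣N
  qD≡ : q * D ≡ suc (2 * k)
  qD≡ = trans (sym N≡qD) N≡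
  2*n≡n+n : ∀ n → 2 * n ≡ n + n
  2*n≡n+n n = cong (n +_) (+-identityʳ n)
  identity : ∀ h g → suc (2 * h) * suc (2 * g) ≡ suc (2 * (h + suc (h + h) * g))
  identity = solve-∀
  split : ∃[ h ] q ≡ suc (2 * h) → ∃[ g ] D ≡ suc (2 * g) →
    Σ ℕ λ h → Σ ℕ λ g → N divN D ≡ suc (h + h) × D ≡ suc (g + g) × k ≡ h + suc (h + h) * g × 1 ≤ h
  split (h , q≡) (g , D≡) = h , g , N/D≡ , trans D≡ (cong suc (2*n≡n+n g)) , k≡ , 1≤h
    where
    N/D≡ : N divN D ≡ suc (h + h)
    N/D≡ = trans (cong (_/ D) N≡qD) (trans (m*n/n≡m q D) (trans q≡ (cong suc (2*n≡n+n h))))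
    k≡ : k ≡ h + suc (h + h) * g
    k≡ = *-cancelˡ-≡ k _ 2 (suc-injective (trans (sym qD≡) (trans (cong₂ _*_ q≡ D≡) (identity h g))))
    1≤h : 1 ≤ h
    1≤h = n≢0⇒n>0 λ h≡0 → <-irrefl refl (<-≤-trans r<N (begin
      N     ≡⟨ N≡qD ⟩
      q * D ≡⟨ cong (_* D) (trans q≡ (cong (λ x → suc (2 * x)) h≡0)) ⟩
      1 * D ≡⟨ *-identityˡ D ⟩
      D     ≤⟨ ∣⇒≤ {{>-nonZero 0<r}} D∣r ⟩
      r     ∎))
      where open ≤-Reasoning

lemma23-via-odd : ∀ c d m h g → c ≡ suc (h + h) → d ≡ suc (g + g) → m ≡ suc (h + suc (h + h) * g) → 1 ≤ h →
  ∀ i j → i < c → j < d →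
    IsOrdering (InM c d i j) (Ord c d i j) m
    × IsOrdering (InM c d (suc i modN c) j) (Ord c d (suc i modN c) j) m
    × EdgeDisjointGraphs (InM c d i j) (InM c d (suc i modN c) j)
    × MsAtLeast m m (Ord c d i j) (Ord c d (suc i modN c) j) (m ∸ 1)
lemma23-via-odd _ _ _ h g refl refl refl = OddGrid.lemma23-odd h g

lemma23 : (m r : ℕ) → 2 ≤ m → 1 ≤ r → r ≤ 2 * m ∸ 2 →
    (i j : ℕ) → i < cOf m r → j < dOf m r →
    IsOrdering (InM (cOf m r) (dOf m r) i j) (Ord (cOf m r) (dOf m r) i j) m
    × IsOrdering (InM (cOf m r) (dOf m r) (suc i modN cOf m r) j)
                 (Ord (cOf m r) (dOf m r) (suc i modN cOf m r) j) m
    × EdgeDisjointGraphs (InM (cOf m r) (dOf m r) i j)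
                         (InM (cOf m r) (dOf m r) (suc i modN cOf m r) j)
    × MsAtLeast m m (Ord (cOf m r) (dOf m r) i j)
                    (Ord (cOf m r) (dOf m r) (suc i modN cOf m r) j) (m ∸ 1)
lemma23 m@(suc k) r 2≤m 1≤r r≤2m∸2
  with odd-divisor-split {k = k} N≡ (gcd[m,n]∣n r N) (gcd[m,n]∣m r N) 1≤r r<N
  where
  N = 2 * m ∸ 1
  N≡ : N ≡ suc (2 * k)
  N≡ = +-suc k (k + 0)
  r<N : r < N
  r<N = <-≤-trans (s≤s r≤2m∸2) (∸-monoʳ-< (s≤s (s≤s z≤n)) (≤-trans 2≤m (m≤n*m m 2)))
... | h , g , c≡ , d≡ , k≡ , 1≤h = lemma23-via-odd (cOf m r) (dOf m r) m h g c≡ d≡ (cong suc k≡) 1≤h
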